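{- Let $k,n,m$ be positive integers and let $x$ be chosen randomly from $[k]^n$ according to the equal-slices measure. Then the probability that there exists $j\in[k]$ such that fewer than $m$ coordinates of $x$ are equal to $j$ is at most $mk^2/n$.
   Context: The equal-slices measure on $[k]^n$: choose, uniformly among all possibilities, a $k$-tuple $(a_1,\dots,a_k)$ of non-negative integers with sum $n$, then choose $x\in[k]^n$ uniformly among the sequences with $|\{i:x_i=j\}|=a_j$ for each $j$. -}

module Defs where

open import Data.Nat as ℕ using (ℕ; zero; suc; _∸_; _<_)
open import Data.Nat.Properties using (_<?_)
open import Data.Fin using (Fin)
open import Data.Fin.Properties using (any?) renaming (_≟_ to _≟ᶠ_)
open import Data.Vec using (Vec; []; _∷_; tabulate; toList)
open import Data.Vec.Properties using (≡-dec)
open import Data.List using (List; []; _∷_; [_]; map; concatMap; filter; length; foldr; allFin; upTo)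
open import Data.Product using (∃)
open import Data.Integer using (+_)
open import Data.Rational using (ℚ; 0ℚ; _+_; _*_; _/_)
open import Relation.Binary.PropositionalEquality using (_≡_)
open import Relation.Nullary using (Dec)

-- all sequences x ∈ [k]^n (coordinates valued in Fin k, i.e. [k] shifted to start at 0)
allSeqs : (k n : ℕ) → List (Vec (Fin k) n)
allSeqs k zero    = [ [] ]
allSeqs k (suc n) = concatMap (λ v → map (_∷ v) (allFin k)) (allSeqs k n)

slices : (k n : ℕ) → List (Vec ℕ k)
slices zero    zero    = [ [] ]
slices zero    (suc n) = []
slices (suc k) n       = concatMap (λ a → map (a ∷_) (slices k (n ∸ a))) (upTo (suc n))

occ : ∀ {k n} → Vec (Fin k) n → Fin k → ℕ
occ x j = length (filter (λ y → y ≟ᶠ j) (toList x))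

counts : ∀ {k n} → Vec (Fin k) n → Vec ℕ k
counts x = tabulate (occ x)

-- rational p/q (q is always nonzero where used; 0 otherwise)
_//_ : ℕ → ℕ → ℚ
p // zero  = 0ℚ
p // suc q = (+ p) / suc q

sumℚ : List ℚ → ℚ
sumℚ = foldr _+_ 0ℚ

-- equal-slices probability of a decidable event E ⊆ [k]^n:
-- choose a slice a uniformly, then x uniformly among sequences with counts a.
equalSlicesProb : (k n : ℕ) (E : Vec (Fin k) n → Set) →
                  ((x : Vec (Fin k) n) → Dec (E x)) → ℚ
equalSlicesProb k n E E? =
  sumℚ (map (λ a → (1 // length (slices k n)) *
                   (length (filter E? (inSlice a)) // length (inSlice a)))
            (slices k n))
  where
  inSlice : Vec ℕ k → List (Vec (Fin k) n)
  inSlice a = filter (λ x → ≡-dec ℕ._≟_ (counts x) a) (allSeqs k n)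

SomeSmall : ∀ {k n} → ℕ → Vec (Fin k) n → Set
SomeSmall m x = ∃ λ j → occ x j < m

someSmall? : ∀ {k n} (m : ℕ) (x : Vec (Fin k) n) → Dec (SomeSmall m x)
someSmall? m x = any? (λ j → occ x j <? m)

-- The event only depends on the slice (a_1, …, a_k) of x, so its equal-slices probability is at
-- most the proportion of slices with some a_j < m.  Splitting a slice into its first part and a
-- slice of the rest, induction on k bounds the number of such slices by m k #slices(k - 1, n),
-- and n #slices(k - 1, n) ≤ (k - 1) #slices(k, n) because #slices(k, n) = C(n + k - 1, k - 1).

module Submission where

open import Defs
open import Data.Nat using (ℕ; zero; suc; _+_; _*_; _∸_; _≤_; _<_; _≥_; z≤n; s≤s; z<s; s<s; s≤s⁻¹; _≤′_; ≤′-refl; ≤′-step; NonZero; >-nonZero)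
open import Data.Nat.Properties
open import Data.Nat.ListAction using (sum)
open import Data.Nat.ListAction.Properties using (sum-++)
open import Data.Nat.Solver using (module +-*-Solver)
open import Data.List using (List; []; _∷_; _++_; map; concatMap; applyUpTo; upTo; length; filter)
open import Data.List.Properties using (map-++; map-∘; map-cong; length-map; length-++; length-filter; filter-none)
open import Data.List.Relation.Unary.All as All using (All)
open import Data.List.Relation.Unary.All.Properties using (all-filter)
open import Data.Vec using (Vec; []; _∷_; lookup)
open import Data.Vec.Properties using (≡-dec; lookup∘tabulate)
open import Data.Fin using (Fin) renaming (zero to fzero; suc to fsuc)
open import Data.Fin.Properties using (any?)
open import Data.Product using (∃; _,_)
open import Data.Empty using (⊥-elim)
import Data.Integer as ℤ
import Data.Integer.Properties as ℤ
import Data.Integer.Solver as ℤ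
open import Data.Rational as ℚ using (ℚ; 0ℚ; 1ℚ)
import Data.Rational.Properties as ℚ
open import Data.Rational.Unnormalised as ℚᵘ using (mkℚᵘ; *≡*; *≤*)
import Data.Rational.Unnormalised.Properties as ℚᵘ
open import Function using (_∘_)
open import Relation.Nullary using (Dec; yes; no; ¬_)
open import Relation.Binary.PropositionalEquality

∑< : ℕ → (ℕ → ℕ) → ℕ
∑< zero    f = 0
∑< (suc n) f = f 0 + ∑< n (f ∘ suc)

syntax ∑< n (λ a → e) = ∑[ a < n ] e

∑-cong : ∀ n {f g : ℕ → ℕ} → (∀ a → a < n → f a ≡ g a) → ∑< n f ≡ ∑< n g
∑-cong zero    eq = refl
∑-cong (suc n) eq = cong₂ _+_ (eq 0 z<s) (∑-cong n (λ a a<n → eq (suc a) (s<s a<n)))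

∑-mono-≤ : ∀ n {f g : ℕ → ℕ} → (∀ a → a < n → f a ≤ g a) → ∑< n f ≤ ∑< n g
∑-mono-≤ zero    le = z≤n
∑-mono-≤ (suc n) le = +-mono-≤ (le 0 z<s) (∑-mono-≤ n (λ a a<n → le (suc a) (s<s a<n)))

∑-zero : ∀ n → ∑[ _ < n ] 0 ≡ 0
∑-zero zero    = refl
∑-zero (suc n) = ∑-zero n

∑-distrib-+ : ∀ n (f g : ℕ → ℕ) → ∑[ a < n ] (f a + g a) ≡ ∑< n f + ∑< n g
∑-distrib-+ zero    f g = refl
∑-distrib-+ (suc n) f g = begin
  (f 0 + g 0) + ∑[ a < n ] (f (suc a) + g (suc a))   ≡⟨ cong ((f 0 + g 0) +_) (∑-distrib-+ n (f ∘ suc) (g ∘ suc)) ⟩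
  (f 0 + g 0) + (∑< n (f ∘ suc) + ∑< n (g ∘ suc))   ≡⟨ solve 4 (λ x y u v → (x :+ y) :+ (u :+ v) := (x :+ u) :+ (y :+ v)) refl
                                                           (f 0) (g 0) (∑< n (f ∘ suc)) (∑< n (g ∘ suc)) ⟩
  (f 0 + ∑< n (f ∘ suc)) + (g 0 + ∑< n (g ∘ suc))   ∎
  where open ≡-Reasoning; open +-*-Solver

*-distribˡ-∑ : ∀ n c (f : ℕ → ℕ) → c * ∑< n f ≡ ∑[ a < n ] (c * f a)
*-distribˡ-∑ zero    c f = *-zeroʳ c
*-distribˡ-∑ (suc n) c f = trans (*-distribˡ-+ c (f 0) (∑< n (f ∘ suc))) (cong (c * f 0 +_) (*-distribˡ-∑ n c (f ∘ suc)))

∑-init-last : ∀ n (f : ℕ → ℕ) → ∑< (suc n) f ≡ ∑< n f + f n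
∑-init-last zero    f = +-comm (f 0) 0
∑-init-last (suc n) f = trans (cong (f 0 +_) (∑-init-last n (f ∘ suc))) (sym (+-assoc (f 0) _ _))

∑-reverse : ∀ (f : ℕ → ℕ) n → ∑< (suc n) f ≡ ∑[ a < suc n ] f (n ∸ a)
∑-reverse f zero    = refl
∑-reverse f (suc n) = begin
  f 0 + ∑< (suc n) (f ∘ suc)                         ≡⟨ cong (f 0 +_) (∑-reverse (f ∘ suc) n) ⟩
  f 0 + ∑[ a < suc n ] f (suc (n ∸ a))               ≡⟨ cong (f 0 +_) (∑-cong (suc n) λ a a<1+n → cong f (sym (+-∸-assoc 1 (s≤s⁻¹ a<1+n)))) ⟩
  f 0 + ∑[ a < suc n ] f (suc n ∸ a)                 ≡⟨ +-comm (f 0) _ ⟩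
  (∑[ a < suc n ] f (suc n ∸ a)) + f 0               ≡⟨ cong (λ b → (∑[ a < suc n ] f (suc n ∸ a)) + f b) (sym (n∸n≡0 n)) ⟩
  (∑[ a < suc n ] f (suc n ∸ a)) + f (suc n ∸ suc n) ≡⟨ sym (∑-init-last (suc n) (λ a → f (suc n ∸ a))) ⟩
  ∑[ a < suc (suc n) ] f (suc n ∸ a)                 ∎
  where open ≡-Reasoning

sum-map-applyUpTo : ∀ (g h : ℕ → ℕ) n → sum (map g (applyUpTo h n)) ≡ ∑[ a < n ] g (h a)
sum-map-applyUpTo g h zero    = refl
sum-map-applyUpTo g h (suc n) = cong (g (h 0) +_) (sum-map-applyUpTo g (h ∘ suc) n)

sum-map-upTo : ∀ (g : ℕ → ℕ) n → sum (map g (upTo n)) ≡ ∑< n g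
sum-map-upTo g = sum-map-applyUpTo g (λ a → a)

sum-map-concatMap : ∀ {A B : Set} (g : B → ℕ) (f : A → List B) xs →
                    sum (map g (concatMap f xs)) ≡ sum (map (λ a → sum (map g (f a))) xs)
sum-map-concatMap g f []       = refl
sum-map-concatMap g f (x ∷ xs) = begin
  sum (map g (f x ++ concatMap f xs))             ≡⟨ cong sum (map-++ g (f x) _) ⟩
  sum (map g (f x) ++ map g (concatMap f xs))     ≡⟨ sum-++ (map g (f x)) _ ⟩
  sum (map g (f x)) + sum (map g (concatMap f xs)) ≡⟨ cong (sum (map g (f x)) +_) (sum-map-concatMap g f xs) ⟩
  sum (map g (f x)) + sum (map (λ a → sum (map g (f a))) xs) ∎
  where open ≡-Reasoning

length-concatMap : ∀ {A B : Set} (f : A → List B) xs → length (concatMap f xs) ≡ sum (map (length ∘ f) xs)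
length-concatMap f []       = refl
length-concatMap f (x ∷ xs) = trans (length-++ (f x)) (cong (length (f x) +_) (length-concatMap f xs))

sum-map-≤-+ : ∀ {A : Set} (f g : A → ℕ) c → (∀ x → f x ≤ c + g x) →
              ∀ xs → sum (map f xs) ≤ c * length xs + sum (map g xs)
sum-map-≤-+ f g c le []       = z≤n
sum-map-≤-+ f g c le (x ∷ xs) = begin
  f x + sum (map f xs)                                ≤⟨ +-mono-≤ (le x) (sum-map-≤-+ f g c le xs) ⟩
  (c + g x) + (c * length xs + sum (map g xs))        ≡⟨ solve 4 (λ c y l s → (c :+ y) :+ (c :* l :+ s) := c :* (con 1 :+ l) :+ (y :+ s))
                                                           refl c (g x) (length xs) (sum (map g xs)) ⟩
  c * suc (length xs) + (g x + sum (map g xs))        ∎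
  where open ≤-Reasoning; open +-*-Solver

𝟙[_<_] : ℕ → ℕ → ℕ
𝟙[ _     < zero  ] = 0
𝟙[ zero  < suc _ ] = 1
𝟙[ suc a < suc m ] = 𝟙[ a < m ]

𝟙[<]≡1 : ∀ {a m} → a < m → 𝟙[ a < m ] ≡ 1
𝟙[<]≡1 {zero}  (s≤s _)   = refl
𝟙[<]≡1 {suc a} (s≤s a<m) = 𝟙[<]≡1 a<m

𝟙[<]≤1 : ∀ a m → 𝟙[ a < m ] ≤ 1
𝟙[<]≤1 a       zero    = z≤n
𝟙[<]≤1 zero    (suc m) = ≤-refl
𝟙[<]≤1 (suc a) (suc m) = 𝟙[<]≤1 a m

n*𝟙[n<m]≤m : ∀ n m → n * 𝟙[ n < m ] ≤ m
n*𝟙[n<m]≤m n       zero    = ≤-reflexive (*-zeroʳ n)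
n*𝟙[n<m]≤m zero    (suc m) = z≤n
n*𝟙[n<m]≤m (suc n) (suc m) = +-mono-≤ (𝟙[<]≤1 n m) (n*𝟙[n<m]≤m n m)

∑-𝟙[<]*-≤ : ∀ N m {f : ℕ → ℕ} {t} → (∀ a → a < N → f a ≤ t) → ∑[ a < N ] (𝟙[ a < m ] * f a) ≤ m * t
∑-𝟙[<]*-≤ zero    m       le = z≤n
∑-𝟙[<]*-≤ (suc N) zero    le = ≤-reflexive (∑-zero N)
∑-𝟙[<]*-≤ (suc N) (suc m) le =
  +-mono-≤ (≤-trans (≤-reflexive (*-identityˡ _)) (le 0 z<s)) (∑-𝟙[<]*-≤ N m (λ a a<N → le (suc a) (s<s a<N)))

#slices : ℕ → ℕ → ℕ
#slices k n = length (slices k n)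

#slices-suc : ∀ k n → #slices (suc k) n ≡ ∑[ a < suc n ] #slices k (n ∸ a)
#slices-suc k n = begin
  length (concatMap (λ a → map (a ∷_) (slices k (n ∸ a))) (upTo (suc n)))
    ≡⟨ length-concatMap (λ a → map (a ∷_) (slices k (n ∸ a))) (upTo (suc n)) ⟩
  sum (map (λ a → length (map (a ∷_) (slices k (n ∸ a)))) (upTo (suc n)))
    ≡⟨ cong sum (map-cong (λ a → length-map (a ∷_) (slices k (n ∸ a))) (upTo (suc n))) ⟩
  sum (map (λ a → #slices k (n ∸ a)) (upTo (suc n)))
    ≡⟨ sum-map-upTo (λ a → #slices k (n ∸ a)) (suc n) ⟩
  ∑[ a < suc n ] #slices k (n ∸ a) ∎
  where open ≡-Reasoning

#slices-cumulative : ∀ k n → #slices (suc k) n ≡ ∑[ b < suc n ] #slices k b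
#slices-cumulative k n = trans (#slices-suc k n) (sym (∑-reverse (#slices k) n))

#slices-pascal : ∀ k n → #slices (suc k) (suc n) ≡ #slices k (suc n) + #slices (suc k) n
#slices-pascal k n = trans (#slices-suc k (suc n)) (cong (#slices k (suc n) +_) (sym (#slices-suc k n)))

#slices-zero : ∀ k → #slices k 0 ≡ 1
#slices-zero zero    = refl
#slices-zero (suc k) = trans (#slices-suc k 0) (trans (+-identityʳ _) (#slices-zero k))

#slices-mono : ∀ k {a n} → a ≤′ n → #slices (suc k) a ≤ #slices (suc k) n
#slices-mono k ≤′-refl             = ≤-refl
#slices-mono k (≤′-step {n = n} p) =
  ≤-trans (#slices-mono k p) (≤-trans (m≤n+m _ _) (≤-reflexive (sym (#slices-pascal k n))))

#slices-pos : ∀ k n → 0 < #slices (suc k) n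
#slices-pos k n = ≤-trans (≤-reflexive (sym (#slices-zero (suc k)))) (#slices-mono k (≤⇒≤′ z≤n))

-- #slices k n = C(n + k - 1, k - 1); these are the two ratio identities of that binomial coefficient.
mutual
  #slices-shiftₙ : ∀ n k → suc n * #slices k (suc n) ≡ (n + k) * #slices k n
  #slices-shiftₙ zero    zero    = refl
  #slices-shiftₙ (suc n) zero    = trans (*-zeroʳ (2 + n)) (sym (*-zeroʳ (suc n + 0)))
  #slices-shiftₙ n       (suc k) = begin
    suc n * #slices (suc k) (suc n)                        ≡⟨ cong (suc n *_) (#slices-pascal k n) ⟩
    suc n * (#slices k (suc n) + #slices (suc k) n)        ≡⟨ *-distribˡ-+ (suc n) (#slices k (suc n)) (#slices (suc k) n) ⟩
    suc n * #slices k (suc n) + suc n * #slices (suc k) n  ≡⟨ cong (_+ suc n * #slices (suc k) n) (#slices-shiftₙ n k) ⟩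
    (n + k) * #slices k n + suc n * #slices (suc k) n      ≡⟨ cong (_+ suc n * #slices (suc k) n) (#slices-shiftₖ n k) ⟩
    k * #slices (suc k) n + suc n * #slices (suc k) n      ≡⟨ sym (*-distribʳ-+ (#slices (suc k) n) k (suc n)) ⟩
    (k + suc n) * #slices (suc k) n                        ≡⟨ cong (_* #slices (suc k) n) (trans (+-comm k (suc n)) (sym (+-suc n k))) ⟩
    (n + suc k) * #slices (suc k) n                        ∎
    where open ≡-Reasoning

  #slices-shiftₖ : ∀ n k → (n + k) * #slices k n ≡ k * #slices (suc k) n
  #slices-shiftₖ zero    k = cong (k *_) (trans (#slices-zero k) (sym (#slices-zero (suc k))))
  #slices-shiftₖ (suc n) k = begin
    (suc n + k) * #slices k (suc n)                  ≡⟨ cong (_* #slices k (suc n)) (+-comm (suc n) k) ⟩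
    (k + suc n) * #slices k (suc n)                  ≡⟨ *-distribʳ-+ (#slices k (suc n)) k (suc n) ⟩
    k * #slices k (suc n) + suc n * #slices k (suc n) ≡⟨ cong (k * #slices k (suc n) +_) (#slices-shiftₙ n k) ⟩
    k * #slices k (suc n) + (n + k) * #slices k n     ≡⟨ cong (k * #slices k (suc n) +_) (#slices-shiftₖ n k) ⟩
    k * #slices k (suc n) + k * #slices (suc k) n     ≡⟨ sym (*-distribˡ-+ k (#slices k (suc n)) (#slices (suc k) n)) ⟩
    k * (#slices k (suc n) + #slices (suc k) n)       ≡⟨ cong (k *_) (sym (#slices-pascal k n)) ⟩
    k * #slices (suc k) (suc n)                       ∎
    where open ≡-Reasoning

n*#slices≤k*#slices : ∀ n k → n * #slices k n ≤ k * #slices (suc k) n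
n*#slices≤k*#slices n k = ≤-trans (*-monoˡ-≤ (#slices k n) (m≤m+n n k)) (≤-reflexive (#slices-shiftₖ n k))

𝟙 : ∀ {P : Set} → Dec P → ℕ
𝟙 (yes _) = 1
𝟙 (no _)  = 0

SmallSlice : ℕ → ∀ {k} → Vec ℕ k → Set
SmallSlice m a = ∃ λ j → lookup a j < m

smallSlice? : ∀ m {k} (a : Vec ℕ k) → Dec (SmallSlice m a)
smallSlice? m a = any? (λ j → lookup a j <? m)

𝟙-smallSlice-[] : ∀ m → 𝟙 (smallSlice? m []) ≡ 0
𝟙-smallSlice-[] m with smallSlice? m []
... | no _ = refl

𝟙-smallSlice-∷ : ∀ m {k} a (v : Vec ℕ k) → 𝟙 (smallSlice? m (a ∷ v)) ≤ 𝟙[ a < m ] + 𝟙 (smallSlice? m v)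
𝟙-smallSlice-∷ m a v with smallSlice? m (a ∷ v)
... | no _               = z≤n
... | yes (fzero , a<m)  = ≤-trans (≤-reflexive (sym (𝟙[<]≡1 a<m))) (m≤m+n _ _)
... | yes (fsuc j , v<m) with smallSlice? m v
...   | yes _    = m≤n+m 1 _
...   | no  ¬small = ⊥-elim (¬small (j , v<m))

#smallSlices : ℕ → ℕ → ℕ → ℕ
#smallSlices m k n = sum (map (λ a → 𝟙 (smallSlice? m a)) (slices k n))

#smallSlices-suc : ∀ m k n →
  #smallSlices m (suc k) n ≤ ∑[ a < suc n ] (𝟙[ a < m ] * #slices k (n ∸ a) + #smallSlices m k (n ∸ a))
#smallSlices-suc m k n = begin
  sum (map χ (concatMap (λ a → map (a ∷_) (slices k (n ∸ a))) (upTo (suc n))))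
    ≡⟨ sum-map-concatMap χ (λ a → map (a ∷_) (slices k (n ∸ a))) (upTo (suc n)) ⟩
  sum (map (λ a → sum (map χ (map (a ∷_) (slices k (n ∸ a))))) (upTo (suc n)))
    ≡⟨ sum-map-upTo (λ a → sum (map χ (map (a ∷_) (slices k (n ∸ a))))) (suc n) ⟩
  ∑[ a < suc n ] sum (map χ (map (a ∷_) (slices k (n ∸ a))))
    ≤⟨ ∑-mono-≤ (suc n) (λ a _ → headBound a (slices k (n ∸ a))) ⟩
  ∑[ a < suc n ] (𝟙[ a < m ] * #slices k (n ∸ a) + #smallSlices m k (n ∸ a)) ∎
  where
  open ≤-Reasoning
  χ : ∀ {k} → Vec ℕ k → ℕ
  χ a = 𝟙 (smallSlice? m a)
  headBound : ∀ a vs → sum (map χ (map (a ∷_) vs)) ≤ 𝟙[ a < m ] * length vs + sum (map χ vs)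
  headBound a vs = ≤-trans (≤-reflexive (cong sum (sym (map-∘ vs))))
                           (sum-map-≤-+ (χ ∘ (a ∷_)) χ 𝟙[ a < m ] (𝟙-smallSlice-∷ m a) vs)

-- The general bound m * k * #slices (k - 1) n fails for k = 1, as #slices 0 n = 0 when n > 0.
#smallSlices-one : ∀ m n → #smallSlices m 1 n ≤ 𝟙[ n < m ]
#smallSlices-one m n = begin
  #smallSlices m 1 n   ≤⟨ #smallSlices-suc m 0 n ⟩
  ∑< (suc n) f         ≡⟨ ∑-init-last n f ⟩
  ∑< n f + f n         ≡⟨ cong₂ _+_ (trans (∑-cong n vanish) (∑-zero n)) lastTerm ⟩
  𝟙[ n < m ]           ∎
  where
  open ≤-Reasoning
  f : ℕ → ℕ
  f a = 𝟙[ a < m ] * #slices 0 (n ∸ a) + #smallSlices m 0 (n ∸ a)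
  vanish : ∀ a → a < n → f a ≡ 0
  vanish a a<n rewrite +-∸-assoc 1 a<n = trans (+-identityʳ _) (*-zeroʳ 𝟙[ a < m ])
  lastTerm : f n ≡ 𝟙[ n < m ]
  lastTerm rewrite n∸n≡0 n | 𝟙-smallSlice-[] m = trans (+-identityʳ _) (*-identityʳ _)

-- A slice with first part a is small because a < m or because its tail is small.  Summing the
-- second case over a gives a cumulative count one dimension lower, hence the invariant below.
mutual
  #smallSlices-cumulative : ∀ m k n → ∑[ b < suc n ] #smallSlices m (suc k) b ≤ m * suc k * #slices (suc k) n
  #smallSlices-cumulative m zero n = begin
    ∑[ b < suc n ] #smallSlices m 1 b  ≤⟨ ∑-mono-≤ (suc n) (λ b _ → ≤-trans (#smallSlices-one m b) (≤-reflexive (sym (*-identityʳ _)))) ⟩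
    ∑[ b < suc n ] (𝟙[ b < m ] * 1)    ≤⟨ ∑-𝟙[<]*-≤ (suc n) m (λ _ _ → ≤-refl) ⟩
    m * 1                              ≤⟨ m≤m*n (m * 1) (#slices 1 n) {{>-nonZero (#slices-pos 0 n)}} ⟩
    m * 1 * #slices 1 n                ∎
    where open ≤-Reasoning
  #smallSlices-cumulative m (suc k) n = begin
    ∑[ b < suc n ] #smallSlices m (2 + k) b           ≤⟨ ∑-mono-≤ (suc n) (λ b _ → #smallSlices≤m*k*#slices m k b) ⟩
    ∑[ b < suc n ] (m * (2 + k) * #slices (suc k) b)  ≡⟨ sym (*-distribˡ-∑ (suc n) (m * (2 + k)) (#slices (suc k))) ⟩
    m * (2 + k) * ∑[ b < suc n ] #slices (suc k) b    ≡⟨ cong (m * (2 + k) *_) (sym (#slices-cumulative (suc k) n)) ⟩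
    m * (2 + k) * #slices (2 + k) n                   ∎
    where open ≤-Reasoning

  #smallSlices≤m*k*#slices : ∀ m k n → #smallSlices m (2 + k) n ≤ m * (2 + k) * #slices (suc k) n
  #smallSlices≤m*k*#slices m k n = begin
    #smallSlices m (2 + k) n
      ≤⟨ #smallSlices-suc m (suc k) n ⟩
    ∑[ a < suc n ] (𝟙[ a < m ] * T (n ∸ a) + #smallSlices m (suc k) (n ∸ a))
      ≡⟨ ∑-distrib-+ (suc n) (λ a → 𝟙[ a < m ] * T (n ∸ a)) (λ a → #smallSlices m (suc k) (n ∸ a)) ⟩
    (∑[ a < suc n ] (𝟙[ a < m ] * T (n ∸ a))) + (∑[ a < suc n ] #smallSlices m (suc k) (n ∸ a))
      ≤⟨ +-mono-≤ (∑-𝟙[<]*-≤ (suc n) m (λ a _ → #slices-mono k (≤⇒≤′ (m∸n≤m n a))))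
                  (≤-reflexive (sym (∑-reverse (#smallSlices m (suc k)) n))) ⟩
    m * T n + (∑[ b < suc n ] #smallSlices m (suc k) b)
      ≤⟨ +-monoʳ-≤ (m * T n) (#smallSlices-cumulative m k n) ⟩
    m * T n + m * suc k * T n
      ≡⟨ solve 3 (λ m k t → m :* t :+ m :* (con 1 :+ k) :* t := m :* (con 2 :+ k) :* t) refl m k (T n) ⟩
    m * (2 + k) * T n ∎
    where
    open ≤-Reasoning
    open +-*-Solver
    T : ℕ → ℕ
    T = #slices (suc k)

n*#smallSlices≤mk²*#slices : ∀ m k n → n * #smallSlices m (suc k) n ≤ m * suc k * suc k * #slices (suc k) n
n*#smallSlices≤mk²*#slices m zero n = begin
  n * #smallSlices m 1 n    ≤⟨ *-monoʳ-≤ n (#smallSlices-one m n) ⟩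
  n * 𝟙[ n < m ]            ≤⟨ n*𝟙[n<m]≤m n m ⟩
  m                         ≤⟨ m≤m*n m (#slices 1 n) {{>-nonZero (#slices-pos 0 n)}} ⟩
  m * #slices 1 n           ≡⟨ cong (_* #slices 1 n) (sym (trans (*-identityʳ (m * 1)) (*-identityʳ m))) ⟩
  m * 1 * 1 * #slices 1 n   ∎
  where open ≤-Reasoning
n*#smallSlices≤mk²*#slices m (suc k) n = begin
  n * #smallSlices m (2 + k) n      ≤⟨ *-monoʳ-≤ n (#smallSlices≤m*k*#slices m k n) ⟩
  n * (c * #slices (suc k) n)       ≡⟨ x∙yz≈y∙xz n c (#slices (suc k) n) ⟩
  c * (n * #slices (suc k) n)       ≤⟨ *-monoʳ-≤ c (n*#slices≤k*#slices n (suc k)) ⟩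
  c * (suc k * #slices (2 + k) n)   ≤⟨ *-monoʳ-≤ c (*-monoˡ-≤ (#slices (2 + k) n) (n≤1+n (suc k))) ⟩
  c * ((2 + k) * #slices (2 + k) n) ≡⟨ sym (*-assoc c (2 + k) _) ⟩
  c * (2 + k) * #slices (2 + k) n   ∎
  where
  open ≤-Reasoning
  open import Algebra.Properties.CommutativeSemigroup *-commutativeSemigroup using (x∙yz≈y∙xz)
  c = m * (2 + k)

//-toℚᵘ : ∀ p s → ℚ.toℚᵘ (p // suc s) ℚᵘ.≃ mkℚᵘ (ℤ.+ p) s
//-toℚᵘ p s = ℚ.toℚᵘ-fromℚᵘ (mkℚᵘ (ℤ.+ p) s)

//-mono-≤ : ∀ p q s t .{{_ : NonZero s}} .{{_ : NonZero t}} → p * t ≤ q * s → p // s ℚ.≤ q // t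
//-mono-≤ p q (suc s) (suc t) p*t≤q*s = ℚ.toℚᵘ-cancel-≤
  (ℚᵘ.≤-respˡ-≃ (ℚᵘ.≃-sym (//-toℚᵘ p s)) (ℚᵘ.≤-respʳ-≃ (ℚᵘ.≃-sym (//-toℚᵘ q t))
    (*≤* (subst₂ ℤ._≤_ (ℤ.pos-* p (suc t)) (ℤ.pos-* q (suc s)) (ℤ.+≤+ p*t≤q*s)))))

//-+ : ∀ p q S .{{_ : NonZero S}} → (p // S) ℚ.+ (q // S) ≡ (p + q) // S
//-+ p q (suc s) = ℚ.toℚᵘ-injective (begin
  ℚ.toℚᵘ (p // suc s ℚ.+ q // suc s)                 ≈⟨ ℚ.toℚᵘ-homo-+ (p // suc s) (q // suc s) ⟩
  ℚ.toℚᵘ (p // suc s) ℚᵘ.+ ℚ.toℚᵘ (q // suc s)       ≈⟨ ℚᵘ.+-cong (//-toℚᵘ p s) (//-toℚᵘ q s) ⟩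
  mkℚᵘ (ℤ.+ p) s ℚᵘ.+ mkℚᵘ (ℤ.+ q) s                 ≈⟨ *≡* (trans (sameDenominator (ℤ.+ p) (ℤ.+ q) (ℤ.+ suc s))
                                                              (cong (ℤ._* (ℤ.+ suc s ℤ.* ℤ.+ suc s)) (sym (ℤ.pos-+ p q)))) ⟩
  mkℚᵘ (ℤ.+ (p + q)) s                               ≈⟨ ℚᵘ.≃-sym (//-toℚᵘ (p + q) s) ⟩
  ℚ.toℚᵘ ((p + q) // suc s)                          ∎)
  where
  open ℚᵘ.≃-Reasoning
  open ℤ.+-*-Solver
  sameDenominator : ∀ x y d → (x ℤ.* d ℤ.+ y ℤ.* d) ℤ.* d ≡ (x ℤ.+ y) ℤ.* (d ℤ.* d)
  sameDenominator = solve 3 (λ x y d → (x :* d :+ y :* d) :* d := (x :+ y) :* (d :* d)) refl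

0//≡0ℚ : ∀ S → 0 // S ≡ 0ℚ
0//≡0ℚ zero    = refl
0//≡0ℚ (suc s) = ℚ.0/n≡0 (suc s)

//-nonNeg : ∀ p S .{{_ : NonZero S}} → 0ℚ ℚ.≤ p // S
//-nonNeg p (suc s) = ℚ.nonNegative⁻¹ (p // suc s) {{ℚ.normalize-nonNeg p (suc s)}}

//≤1 : ∀ {p q} → p ≤ q → p // q ℚ.≤ 1ℚ
//≤1 {q = zero}  _   = ℚ.*≤* (ℤ.+≤+ z≤n)
//≤1 {p} {suc q} p≤q =
  //-mono-≤ p 1 (suc q) 1 (subst₂ _≤_ (sym (*-identityʳ p)) (sym (*-identityˡ (suc q))) p≤q)

sumℚ-≤ : ∀ {A : Set} S .{{_ : NonZero S}} (f : A → ℚ) (g : A → ℕ) →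
         (∀ x → f x ℚ.≤ g x // S) → ∀ xs → sumℚ (map f xs) ℚ.≤ sum (map g xs) // S
sumℚ-≤ S f g le []       = ℚ.≤-reflexive (sym (0//≡0ℚ S))
sumℚ-≤ S f g le (x ∷ xs) =
  subst (sumℚ (map f (x ∷ xs)) ℚ.≤_) (//-+ (g x) (sum (map g xs)) S) (ℚ.+-mono-≤ (le x) (sumℚ-≤ S f g le xs))

slice-term-≤ : ∀ S .{{_ : NonZero S}} {P : Set} (P? : Dec P) {F G} → F ≤ G → (¬ P → F ≡ 0) →
               (1 // S) ℚ.* (F // G) ℚ.≤ 𝟙 P? // S
slice-term-≤ (suc s) (yes _) F≤G _ =
  subst ((1 // suc s) ℚ.* _ ℚ.≤_) (ℚ.*-identityʳ (1 // suc s))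
        (ℚ.*-monoˡ-≤-nonNeg (1 // suc s) {{ℚ.normalize-nonNeg 1 (suc s)}} (//≤1 F≤G))
slice-term-≤ (suc s) (no ¬p) {G = G} _ F≡0 rewrite F≡0 ¬p | 0//≡0ℚ G | ℚ.*-zeroʳ (1 // suc s) = //-nonNeg 0 (suc s)

slice : ∀ {k n} → Vec ℕ k → List (Vec (Fin k) n)
slice {k} {n} a = filter (λ x → ≡-dec _≟_ (counts x) a) (allSeqs k n)

someSmall⇒smallSlice : ∀ m {k n} {x : Vec (Fin k) n} {a} → counts x ≡ a → SomeSmall m x → SmallSlice m a
someSmall⇒smallSlice m {x = x} refl (j , occ<m) = j , subst (_< m) (sym (lookup∘tabulate (occ x) j)) occ<m

equalSlicesProb≤ : ∀ m k n .{{_ : NonZero (#slices k n)}} →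
                   equalSlicesProb k n (SomeSmall m) (someSmall? m) ℚ.≤ #smallSlices m k n // #slices k n
equalSlicesProb≤ m k n = sumℚ-≤ (#slices k n) _ (λ a → 𝟙 (smallSlice? m a)) term (slices k n)
  where
  term : ∀ a → (1 // #slices k n) ℚ.* (length (filter (someSmall? m) (slice {n = n} a)) // length (slice {n = n} a))
                 ℚ.≤ 𝟙 (smallSlice? m a) // #slices k n
  term a = slice-term-≤ (#slices k n) (smallSlice? m a) (length-filter (someSmall? m) (slice {n = n} a))
    λ ¬small → cong length (filter-none (someSmall? m)
      (All.map (λ {x} counts≡a → ¬small ∘ someSmall⇒smallSlice m {x = x} counts≡a) (all-filter _ (allSeqs k n))))

corollary3p5 : (k n m : ℕ) → k ≥ 1 → n ≥ 1 → m ≥ 1 →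
    equalSlicesProb k n (SomeSmall m) (someSmall? m) ℚ.≤ ((m * k * k) // n)
-- The bound also holds for m = 0.
corollary3p5 (suc k) (suc n) m (s≤s z≤n) (s≤s z≤n) _ =
  ℚ.≤-trans (equalSlicesProb≤ m (suc k) (suc n)) (//-mono-≤ _ (m * suc k * suc k) _ (suc n) density)
  where
  instance
    #slices≢0 : NonZero (#slices (suc k) (suc n))
    #slices≢0 = >-nonZero (#slices-pos k (suc n))
  density : #smallSlices m (suc k) (suc n) * suc n ≤ m * suc k * suc k * #slices (suc k) (suc n)
  density = subst (_≤ m * suc k * suc k * #slices (suc k) (suc n)) (*-comm (suc n) _) (n*#smallSlices≤mk²*#slices m k (suc n))
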